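{- Let $\mathbf{a}<\mathbf{b}$ be positive co-prime integers and $k$ a positive integer. For $n,m\in\mathbb{N}$ let $A_{nm}=\{\alpha k\mathbf{a}+\beta k\mathbf{b}\mid \alpha\in\{0,\dots,n\},\ \beta\in\{0,\dots,m\}\}$. Let $(n_1,m_1),\dots,(n_t,m_t)\in\mathbb{N}^2$ with $n_i+m_i>0$ for all $i$, let $b_1,\dots,b_p,a_1,\dots,a_s$ be positive integers with $s\le t$, and let $S$ be the sumset semigroup generated by the list $$\{b_1\},\dots,\{b_p\},\ \{a_1\}+A_{n_1m_1},\dots,\{a_s\}+A_{n_sm_s},\ A_{n_{s+1}m_{s+1}},\dots,A_{n_tm_t},$$ with ideal $I_S\subset\mathbf{k}[x_1,\dots,x_p,z_1,\dots,z_t]$, where $x_j$ corresponds to $\{b_j\}$, $z_i$ to $\{a_i\}+A_{n_im_i}$ for $i\le s$, and $z_i$ to $A_{n_im_i}$ for $i>s$. Let $S'$ be the sumset semigroup generated by $\{b_1\},\dots,\{b_p\},\{a_1\},\dots,\{a_s\},\{0,k\mathbf{a}\},\{0,k\mathbf{b}\}$, with ideal $I_{S'}\subset\mathbf{k}[x_1,\dots,x_p,w_1,\dots,w_s,x,y]$, where $x_j$ corresponds to $\{b_j\}$, $w_i$ to $\{a_i\}$, $x$ to $\{0,k\mathbf{a}\}$ and $y$ to $\{0,k\mathbf{b}\}$. Then, in $\mathbf{k}[x_1,\dots,x_p,w_1,\dots,w_s,x,y,z_1,\dots,z_t]$, $$I_S=\Big(I_{S'}+\big\langle z_1-w_1x^{n_1}y^{m_1},\dots,z_s-w_sx^{n_s}y^{m_s},\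 z_{s+1}-x^{n_{s+1}}y^{m_{s+1}},\dots,z_t-x^{n_t}y^{m_t}\big\rangle\Big)\cap\mathbf{k}[x_1,\dots,x_p,z_1,\dots,z_t].$$
   Context: $\mathrm{FS}(\mathbb{N})$ is the monoid of finite non-empty subsets of $\mathbb{N}$ under $A+B=\{a+b\mid a\in A,b\in B\}$ with identity $\{0\}$; $\alpha\otimes A$ is the $\alpha$-fold sum of $A$ ($0\otimes A=\{0\}$). A sumset semigroup is a finitely generated submonoid of $\mathrm{FS}(\mathbb{N})$. For a field $\mathbf{k}$ and a list of generators $A_1,\dots,A_r$ of a sumset semigroup $S$, with variables $u_1,\dots,u_r$ assigned to them, the ideal $I_S\subset\mathbf{k}[u_1,\dots,u_r]$ is the binomial ideal generated by all $u_1^{\alpha_1}\cdots u_r^{\alpha_r}-u_1^{\beta_1}\cdots u_r^{\beta_r}$ with $\sum_i\alpha_i\otimes A_i=\sum_i\beta_i\otimes A_i$. -}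

module Defs where

open import Level using (Level; _⊔_; suc)
open import Algebra.Bundles using (CommutativeRing)
open import Data.Nat as ℕ using (ℕ; zero; _+_; _*_; _<_)
open import Data.Nat.GCD using (gcd)
open import Data.Fin using (Fin; splitAt)
open import Data.Sum using (_⊎_; inj₁; inj₂)
open import Data.Product using (Σ; _×_; _,_; ∃)
open import Data.List as L using (List; []; _∷_; upTo; concatMap; _++_)
open import Data.List.Membership.Propositional using (_∈_)
open import Data.Vec as V using (Vec; []; _∷_; replicate; _[_]≔_; zipWith)
open import Data.Vec.Properties using (≡-dec)
open import Data.Nat.Properties using () renaming (_≟_ to _≟ℕ_)
open import Relation.Nullary using (¬_; yes; no)
open import Relation.Binary.PropositionalEquality using (_≡_)
open import Function.Bundles using (_⇔_)

record Field (c ℓ : Level) : Set (suc (c ⊔ ℓ)) where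
  field
    commRing : CommutativeRing c ℓ
  open CommutativeRing commRing public
    renaming (_+_ to _+F_; _*_ to _*F_; -_ to -F_)
  field
    1≉0     : ¬ (1# ≈ 0#)
    inverse : ∀ x → ¬ (x ≈ 0#) → ∃ λ y → (x *F y) ≈ 1#

-- Finite non-empty subsets of ℕ are represented by lists; two lists
-- represent the same subset when they have the same members.

_≋_ : List ℕ → List ℕ → Set
A ≋ B = ∀ x → (x ∈ A) ⇔ (x ∈ B)

_⊕_ : List ℕ → List ℕ → List ℕ
A ⊕ B = concatMap (λ a → L.map (a +_) B) A

_⊗_ : ℕ → List ℕ → List ℕ
zero    ⊗ A = 0 ∷ []
ℕ.suc α ⊗ A = A ⊕ (α ⊗ A)

lin : ∀ {r} → Vec ℕ r → Vec (List ℕ) r → List ℕ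
lin []      []      = 0 ∷ []
lin (α ∷ αs) (A ∷ As) = (α ⊗ A) ⊕ lin αs As

Anm : (k a b n m : ℕ) → List ℕ
Anm k a b n m =
  concatMap (λ α → L.map (λ β → α * k * a + β * k * b) (upTo (ℕ.suc m)))
            (upTo (ℕ.suc n))

-- Polynomials over a field F in N variables: finite lists of terms
-- (coefficient, exponent vector); equality is coefficientwise.

module Poly {c ℓ} (F : Field c ℓ) where
  open Field F

  Mon : ℕ → Set
  Mon N = Vec ℕ N

  Pol : ℕ → Set c
  Pol N = List (Carrier × Mon N)

  coeff : ∀ {N} → Pol N → Mon N → Carrier
  coeff []             e = 0#
  coeff ((a , e') ∷ f) e with ≡-dec _≟ℕ_ e' e
  ... | yes _ = a +F coeff f e
  ... | no  _ = coeff f e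

  _≈P_ : ∀ {N} → Pol N → Pol N → Set ℓ
  f ≈P g = ∀ e → coeff f e ≈ coeff g e

  0P : ∀ {N} → Pol N
  0P = []

  _+P_ : ∀ {N} → Pol N → Pol N → Pol N
  f +P g = f ++ g

  _*P_ : ∀ {N} → Pol N → Pol N → Pol N
  f *P g = concatMap (λ { (a , e) → L.map (λ { (b , e') → (a *F b , zipWith _+_ e e') }) g }) f

  binom : ∀ {N} → Mon N → Mon N → Pol N
  binom α β = (1# , α) ∷ (-F 1# , β) ∷ []

  InIdeal : ∀ {N} {I : Set} → (I → Pol N) → Pol N → Set (c ⊔ ℓ)
  InIdeal {N} {I} gen f =
    ∃ λ (hs : List (Pol N × I)) →
      f ≈P L.foldr (λ { (h , i) acc → (h *P gen i) +P acc }) 0P hs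

  -- the ideal I_S of a list of generators A_1..A_r (variables u_1..u_r):
  -- generated by all u^α − u^β with Σ α_i ⊗ A_i = Σ β_i ⊗ A_i
  SIdx : ∀ {r} → Vec (List ℕ) r → Set
  SIdx {r} As = Σ (Mon r × Mon r) λ { (α , β) → lin α As ≋ lin β As }

  sgen : ∀ {r} (As : Vec (List ℕ) r) → SIdx As → Pol r
  sgen As ((α , β) , _) = binom α β

  InIS : ∀ {r} → Vec (List ℕ) r → Pol r → Set (c ⊔ ℓ)
  InIS As = InIdeal (sgen As)

  mapMon : ∀ {N M} → (Mon N → Mon M) → Pol N → Pol M
  mapMon φ = L.map (λ { (a , e) → (a , φ e) })

-- The data of Theorem 1.1.  Here t = s + u.

gensS : (k a b p s u : ℕ) → (Fin p → ℕ) → (Fin s → ℕ) →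
        (Fin (s + u) → ℕ × ℕ) → Vec (List ℕ) (p + (s + u))
gensS k a b p s u bs as nm =
  V.tabulate (λ j → bs j ∷ []) V.++
  V.tabulate (λ i → piece i (splitAt s i))
  where
  piece : Fin (s + u) → Fin s ⊎ Fin u → List ℕ
  piece i (inj₁ i') with nm i
  ... | (n , m) = (as i' ∷ []) ⊕ Anm k a b n m
  piece i (inj₂ _)  with nm i
  ... | (n , m) = Anm k a b n m

gensS' : (k a b p s : ℕ) → (Fin p → ℕ) → (Fin s → ℕ) →
         Vec (List ℕ) (p + (s + 2))
gensS' k a b p s bs as =
  V.tabulate (λ j → bs j ∷ []) V.++
  (V.tabulate (λ i → as i ∷ []) V.++
   ((0 ∷ k * a ∷ []) ∷ (0 ∷ k * b ∷ []) ∷ []))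

-- Big ring k[x_1..x_p, w_1..w_s, x, y, z_1..z_t]:
-- exponent vectors of length (p + (s + 2)) + (s + u).
Big : (p s u : ℕ) → ℕ
Big p s u = (p + (s + 2)) + (s + u)

inclXZ : (p s u : ℕ) → Vec ℕ (p + (s + u)) → Vec ℕ (Big p s u)
inclXZ p s u e with V.splitAt p e
... | (ex , ez , _) = (ex V.++ replicate (s + 2) 0) V.++ ez

inclS' : (p s u : ℕ) → Vec ℕ (p + (s + 2)) → Vec ℕ (Big p s u)
inclS' p s u e = e V.++ replicate (s + u) 0

unit : ∀ {n} → Fin n → Vec ℕ n
unit i = replicate _ 0 [ i ]≔ 1

zMon : (p s u : ℕ) → Fin (s + u) → Vec ℕ (Big p s u)
zMon p s u i = replicate (p + (s + 2)) 0 V.++ unit i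

wxyMon : (p s u : ℕ) → (Fin (s + u) → ℕ × ℕ) → Fin (s + u) → Vec ℕ (Big p s u)
wxyMon p s u nm i = (replicate p 0 V.++ (wpart (splitAt s i) V.++ xy (nm i)))
                    V.++ replicate (s + u) 0
  where
  wpart : Fin s ⊎ Fin u → Vec ℕ s
  wpart (inj₁ i') = unit i'
  wpart (inj₂ _)  = replicate s 0
  xy : ℕ × ℕ → Vec ℕ 2
  xy (n , m) = n ∷ m ∷ []

module Thm {c ℓ} (F : Field c ℓ) where
  open Poly F public

  Jgen : (k a b p s u : ℕ) (bs : Fin p → ℕ) (as : Fin s → ℕ)
         (nm : Fin (s + u) → ℕ × ℕ) →
         SIdx (gensS' k a b p s bs as) ⊎ Fin (s + u) → Pol (Big p s u)
  Jgen k a b p s u bs as nm (inj₁ ((α , β) , _)) =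
    binom (inclS' p s u α) (inclS' p s u β)
  Jgen k a b p s u bs as nm (inj₂ i) = binom (zMon p s u i) (wxyMon p s u nm i)

{-# OPTIONS --safe #-}
module Submission where

-- The ideal I_S is spanned by the binomials u^α − u^β whose exponents have the same degree
-- Σ αᵢ ⊗ Aᵢ, so a polynomial lies in I_S exactly when, for every degree class, its coefficients
-- on the monomials of that class sum to zero.  The same criterion describes
-- J = I_S′ + ⟨zᵢ − wᵢ x^nᵢ y^mᵢ⟩ once the big ring is graded by giving zᵢ the degree of the
-- i-th generator of S: the generators of J are homogeneous because A_nm = n ⊗ {0,ka} + m ⊗ {0,kb},
-- and two monomials of the same degree are connected modulo J, since every zᵢ can be traded for
-- wᵢ x^nᵢ y^mᵢ and two monomials of equal degree in the variables of S′ differ by a generator of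
-- I_S′.  The inclusion of k[x, z] preserves degrees, so the two criteria agree on polynomials in
-- x and z.

open import Defs
open import Algebra.Bundles using (CommutativeMonoid)
open import Algebra.Structures using (IsCommutativeMonoid)
open import Data.Bool using (Bool; true; false; if_then_else_)
open import Data.Empty using (⊥-elim)
open import Data.Fin as Fin using (Fin; splitAt)
open import Data.List as L using (List; []; _∷_; _++_; upTo)
import Data.List.Properties as LP
open import Data.List.Membership.Propositional using (_∈_; find; lose)
open import Data.List.Membership.Propositional.Properties
  using (∈-concatMap⁺; ∈-concatMap⁻; ∈-map⁺; ∈-map⁻; ∈-upTo⁺; ∈-upTo⁻; ∈-++⁺ˡ; ∈-++⁺ʳ;
         ∈-deduplicate⁺)
open import Data.List.Relation.Binary.Subset.Propositional using (_⊆_)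
open import Data.List.Relation.Unary.All as All using (All; []; _∷_; all?)
open import Data.List.Relation.Unary.All.Properties.Core using (¬Any⇒All¬)
open import Data.List.Relation.Unary.AllPairs using (_∷_)
open import Data.List.Relation.Unary.Any using (here; there; any?)
open import Data.List.Relation.Unary.Unique.Propositional using (Unique)
open import Data.List.Relation.Unary.Unique.DecPropositional.Properties using (deduplicate-!)
open import Data.Nat as ℕ using (ℕ; zero; suc; _+_; _*_; _≤_; _<_; z≤n; s≤s)
import Data.Nat.Properties as ℕ
open import Data.Nat.GCD using (gcd)
open import Data.List.Membership.DecPropositional ℕ._≟_ using (_∈?_)
open import Data.Product using (_×_; _,_; proj₁; proj₂; ∃; ∃₂)
open import Data.Sum using (_⊎_; inj₁; inj₂)
open import Data.Vec as V using (Vec; []; _∷_; replicate; zipWith)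
open import Data.Vec.Properties
  using (≡-dec; lookup∘tabulate; zipWith-++; zipWith-identityˡ; zipWith-identityʳ)
open import Function using (_∋_)
open import Function.Bundles using (_⇔_; mk⇔; Equivalence)
open import Function.Construct.Composition using (_⇔-∘_)
open import Function.Construct.Symmetry using (⇔-sym)
open import Function.Properties.Equivalence using (⇔-isEquivalence)
open import Level using (0ℓ; _⊔_)
open import Relation.Binary.Bundles using (Setoid)
open import Relation.Binary.Definitions using (Decidable)
open import Relation.Binary.PropositionalEquality as ≡ using (_≡_; refl; cong; cong₂; subst)
import Relation.Binary.Reasoning.Setoid
open import Relation.Binary.Structures using (IsEquivalence)
open import Relation.Nullary using (¬_; yes; no; does)
open import Relation.Nullary.Decidable using (dec-true; dec-false; does-⇔; map′)

open Equivalence using (to; from)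

private
  module ⇔ = IsEquivalence (⇔-isEquivalence {0ℓ})

-- Sumsets

≋-isEquivalence : IsEquivalence _≋_
≋-isEquivalence = record
  { refl  = λ _ → ⇔.refl
  ; sym   = λ A≋B x → ⇔.sym (A≋B x)
  ; trans = λ A≋B B≋C x → ⇔.trans (A≋B x) (B≋C x)
  }

≋-setoid : Setoid 0ℓ 0ℓ
≋-setoid = record { isEquivalence = ≋-isEquivalence }

open IsEquivalence ≋-isEquivalence public
  using () renaming (refl to ≋-refl; sym to ≋-sym; trans to ≋-trans; reflexive to ≡⇒≋)

⊆-antisym : ∀ {A B} → A ⊆ B → B ⊆ A → A ≋ B
⊆-antisym A⊆B B⊆A x = mk⇔ A⊆B B⊆A

_≋?_ : Decidable _≋_
A ≋? B with all? (_∈? B) A | all? (_∈? A) B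
... | yes A⊆B | yes B⊆A = yes (⊆-antisym (All.lookup A⊆B) (All.lookup B⊆A))
... | no A⊈B  | _       = no λ A≋B → A⊈B (All.tabulate (to (A≋B _)))
... | yes _   | no B⊈A  = no λ A≋B → B⊈A (All.tabulate (from (A≋B _)))

[0] : List ℕ
[0] = 0 ∷ []

∈-⊕⁻ : ∀ A B {x} → x ∈ A ⊕ B → ∃₂ λ a b → a ∈ A × b ∈ B × x ≡ a + b
∈-⊕⁻ A B x∈ with find (∈-concatMap⁻ (λ a → L.map (a +_) B) {xs = A} x∈)
... | a , a∈A , x∈a+B with ∈-map⁻ (a +_) x∈a+B
...   | b , b∈B , x≡a+b = a , b , a∈A , b∈B , x≡a+b

∈-⊕⁺ : ∀ A B {a b} → a ∈ A → b ∈ B → a + b ∈ A ⊕ B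
∈-⊕⁺ A B {a} a∈A b∈B = ∈-concatMap⁺ (λ a → L.map (a +_) B) (lose a∈A (∈-map⁺ (a +_) b∈B))

⊕-mono : ∀ {A A′ B B′} → A ⊆ A′ → B ⊆ B′ → A ⊕ B ⊆ A′ ⊕ B′
⊕-mono {A} {A′} {B} {B′} A⊆A′ B⊆B′ x∈ with ∈-⊕⁻ A B x∈
... | a , b , a∈A , b∈B , refl = ∈-⊕⁺ A′ B′ (A⊆A′ a∈A) (B⊆B′ b∈B)

⊕-cong : ∀ {A A′ B B′} → A ≋ A′ → B ≋ B′ → (A ⊕ B) ≋ (A′ ⊕ B′)
⊕-cong A≋A′ B≋B′ = ⊆-antisym (⊕-mono (to (A≋A′ _)) (to (B≋B′ _)))
                             (⊕-mono (from (A≋A′ _)) (from (B≋B′ _)))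

⊕-comm-⊆ : ∀ A B → A ⊕ B ⊆ B ⊕ A
⊕-comm-⊆ A B x∈ with ∈-⊕⁻ A B x∈
... | a , b , a∈A , b∈B , refl = subst (_∈ B ⊕ A) (ℕ.+-comm b a) (∈-⊕⁺ B A b∈B a∈A)

⊕-comm : ∀ A B → (A ⊕ B) ≋ (B ⊕ A)
⊕-comm A B = ⊆-antisym (⊕-comm-⊆ A B) (⊕-comm-⊆ B A)

⊕-assoc : ∀ A B C → ((A ⊕ B) ⊕ C) ≋ (A ⊕ (B ⊕ C))
⊕-assoc A B C = ⊆-antisym assocʳ assocˡ
  where
  assocʳ : (A ⊕ B) ⊕ C ⊆ A ⊕ (B ⊕ C)
  assocʳ x∈ with ∈-⊕⁻ (A ⊕ B) C x∈
  ... | _ , c , ab∈ , c∈C , refl with ∈-⊕⁻ A B ab∈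
  ...   | a , b , a∈A , b∈B , refl =
    subst (_∈ A ⊕ (B ⊕ C)) (≡.sym (ℕ.+-assoc a b c))
          (∈-⊕⁺ A (B ⊕ C) a∈A (∈-⊕⁺ B C b∈B c∈C))
  assocˡ : A ⊕ (B ⊕ C) ⊆ (A ⊕ B) ⊕ C
  assocˡ x∈ with ∈-⊕⁻ A (B ⊕ C) x∈
  ... | a , _ , a∈A , bc∈ , refl with ∈-⊕⁻ B C bc∈
  ...   | b , c , b∈B , c∈C , refl =
    subst (_∈ (A ⊕ B) ⊕ C) (ℕ.+-assoc a b c)
          (∈-⊕⁺ (A ⊕ B) C (∈-⊕⁺ A B a∈A b∈B) c∈C)

⊕-identityˡ : ∀ A → ([0] ⊕ A) ≋ A
⊕-identityˡ A = ⊆-antisym 0+A⊆A (∈-⊕⁺ [0] A (here refl))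
  where
  0+A⊆A : [0] ⊕ A ⊆ A
  0+A⊆A x∈ with ∈-⊕⁻ [0] A x∈
  ... | _ , b , here refl , b∈A , refl = b∈A

⊕-identityʳ : ∀ A → (A ⊕ [0]) ≋ A
⊕-identityʳ A = ≋-trans (⊕-comm A [0]) (⊕-identityˡ A)

⊕-isCommutativeMonoid : IsCommutativeMonoid _≋_ _⊕_ [0]
⊕-isCommutativeMonoid = record
  { isMonoid = record
    { isSemigroup = record
      { isMagma = record { isEquivalence = ≋-isEquivalence ; ∙-cong = ⊕-cong }
      ; assoc   = ⊕-assoc
      }
    ; identity = ⊕-identityˡ , ⊕-identityʳ
    }
  ; comm = ⊕-comm
  }

⊕-commutativeMonoid : CommutativeMonoid 0ℓ 0ℓ
⊕-commutativeMonoid = record { isCommutativeMonoid = ⊕-isCommutativeMonoid }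

open import Algebra.Properties.CommutativeSemigroup
  (CommutativeMonoid.commutativeSemigroup ⊕-commutativeMonoid)
  using () renaming (interchange to ⊕-interchange)

module ≋-Reasoning = Relation.Binary.Reasoning.Setoid ≋-setoid

⊗-+ : ∀ m n A → ((m + n) ⊗ A) ≋ ((m ⊗ A) ⊕ (n ⊗ A))
⊗-+ zero    n A = ≋-sym (⊕-identityˡ (n ⊗ A))
⊗-+ (suc m) n A = begin
  A ⊕ ((m + n) ⊗ A)           ≈⟨ ⊕-cong (≋-refl {A}) (⊗-+ m n A) ⟩
  A ⊕ ((m ⊗ A) ⊕ (n ⊗ A))     ≈⟨ ⊕-assoc A (m ⊗ A) (n ⊗ A) ⟨
  (A ⊕ (m ⊗ A)) ⊕ (n ⊗ A)     ∎
  where open ≋-Reasoning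

lin-+ : ∀ {r} (α β : Vec ℕ r) As → lin (zipWith _+_ α β) As ≋ (lin α As ⊕ lin β As)
lin-+ []      []      []       = ≋-sym (⊕-identityˡ [0])
lin-+ (a ∷ α) (b ∷ β) (A ∷ As) = begin
  ((a + b) ⊗ A) ⊕ lin (zipWith _+_ α β) As       ≈⟨ ⊕-cong (⊗-+ a b A) (lin-+ α β As) ⟩
  ((a ⊗ A) ⊕ (b ⊗ A)) ⊕ (lin α As ⊕ lin β As)    ≈⟨ ⊕-interchange (a ⊗ A) (b ⊗ A) (lin α As) (lin β As) ⟩
  ((a ⊗ A) ⊕ lin α As) ⊕ ((b ⊗ A) ⊕ lin β As)    ∎
  where open ≋-Reasoning

lin-++ : ∀ {m n} (α : Vec ℕ m) (β : Vec ℕ n) As Bs →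
         lin (α V.++ β) (As V.++ Bs) ≋ (lin α As ⊕ lin β Bs)
lin-++ []      β []       Bs = ≋-sym (⊕-identityˡ (lin β Bs))
lin-++ (a ∷ α) β (A ∷ As) Bs = begin
  (a ⊗ A) ⊕ lin (α V.++ β) (As V.++ Bs)   ≈⟨ ⊕-cong (≋-refl {a ⊗ A}) (lin-++ α β As Bs) ⟩
  (a ⊗ A) ⊕ (lin α As ⊕ lin β Bs)         ≈⟨ ⊕-assoc (a ⊗ A) (lin α As) (lin β Bs) ⟨
  ((a ⊗ A) ⊕ lin α As) ⊕ lin β Bs         ∎
  where open ≋-Reasoning

lin-zeros : ∀ {r} (As : Vec (List ℕ) r) → lin (replicate r 0) As ≋ [0]
lin-zeros []       = ≋-refl
lin-zeros (A ∷ As) = ≋-trans (⊕-identityˡ _) (lin-zeros As)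

lin-unit : ∀ {r} (i : Fin r) (As : Vec (List ℕ) r) → lin (unit i) As ≋ V.lookup As i
lin-unit Fin.zero    (A ∷ As) = ≋-trans (⊕-cong (⊕-identityʳ A) (lin-zeros As)) (⊕-identityʳ A)
lin-unit (Fin.suc i) (A ∷ As) = ≋-trans (⊕-identityˡ _) (lin-unit i As)

⟨0,_⟩ : ℕ → List ℕ
⟨0, d ⟩ = 0 ∷ d ∷ []

∈-⊗⟨0,⟩⁻ : ∀ n d {x} → x ∈ n ⊗ ⟨0, d ⟩ → ∃ λ α → α ≤ n × x ≡ α * d
∈-⊗⟨0,⟩⁻ zero    d (here refl) = 0 , z≤n , refl
∈-⊗⟨0,⟩⁻ (suc n) d x∈ with ∈-⊕⁻ ⟨0, d ⟩ (n ⊗ ⟨0, d ⟩) x∈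
... | _ , _ , y∈ , z∈ , refl with ∈-⊗⟨0,⟩⁻ n d z∈
...   | α , α≤n , refl with y∈
...     | here refl         = α , ℕ.m≤n⇒m≤1+n α≤n , refl
...     | there (here refl) = suc α , s≤s α≤n , refl

∈-⊗⟨0,⟩⁺ : ∀ n d {α} → α ≤ n → α * d ∈ n ⊗ ⟨0, d ⟩
∈-⊗⟨0,⟩⁺ zero    d z≤n       = here refl
∈-⊗⟨0,⟩⁺ (suc n) d z≤n       = ∈-⊕⁺ ⟨0, d ⟩ _ (here refl) (∈-⊗⟨0,⟩⁺ n d z≤n)
∈-⊗⟨0,⟩⁺ (suc n) d (s≤s α≤n) = ∈-⊕⁺ ⟨0, d ⟩ _ (there (here refl)) (∈-⊗⟨0,⟩⁺ n d α≤n)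

module _ (k a b n m : ℕ) where

  private
    point : ℕ → ℕ → ℕ
    point α β = α * k * a + β * k * b

  ∈-Anm⁻ : ∀ {x} → x ∈ Anm k a b n m → ∃₂ λ α β → α ≤ n × β ≤ m × x ≡ point α β
  ∈-Anm⁻ x∈ with find (∈-concatMap⁻ (λ α → L.map (point α) (upTo (suc m))) {xs = upTo (suc n)} x∈)
  ... | α , α∈ , x∈row with ∈-map⁻ (point α) x∈row
  ...   | β , β∈ , x≡ = α , β , ℕ.≤-pred (∈-upTo⁻ α∈) , ℕ.≤-pred (∈-upTo⁻ β∈) , x≡

  ∈-Anm⁺ : ∀ {α β} → α ≤ n → β ≤ m → point α β ∈ Anm k a b n m
  ∈-Anm⁺ {α} α≤n β≤m = ∈-concatMap⁺ (λ α → L.map (point α) (upTo (suc m)))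
    (lose (∈-upTo⁺ (s≤s α≤n)) (∈-map⁺ (point α) (∈-upTo⁺ (s≤s β≤m))))

  Anm≋⊗⊕⊗ : Anm k a b n m ≋ ((n ⊗ ⟨0, k * a ⟩) ⊕ (m ⊗ ⟨0, k * b ⟩))
  Anm≋⊗⊕⊗ = ⊆-antisym Anm⊆ ⊆Anm
    where
    point≡ : ∀ α β → point α β ≡ α * (k * a) + β * (k * b)
    point≡ α β = cong₂ _+_ (ℕ.*-assoc α k a) (ℕ.*-assoc β k b)
    Anm⊆ : Anm k a b n m ⊆ (n ⊗ ⟨0, k * a ⟩) ⊕ (m ⊗ ⟨0, k * b ⟩)
    Anm⊆ x∈ with ∈-Anm⁻ x∈
    ... | α , β , α≤n , β≤m , refl =
      subst (_∈ (n ⊗ ⟨0, k * a ⟩) ⊕ (m ⊗ ⟨0, k * b ⟩)) (≡.sym (point≡ α β))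
            (∈-⊕⁺ (n ⊗ _) (m ⊗ _) (∈-⊗⟨0,⟩⁺ n (k * a) α≤n) (∈-⊗⟨0,⟩⁺ m (k * b) β≤m))
    ⊆Anm : (n ⊗ ⟨0, k * a ⟩) ⊕ (m ⊗ ⟨0, k * b ⟩) ⊆ Anm k a b n m
    ⊆Anm x∈ with ∈-⊕⁻ (n ⊗ _) (m ⊗ _) x∈
    ... | _ , _ , y∈ , z∈ , refl with ∈-⊗⟨0,⟩⁻ n (k * a) y∈ | ∈-⊗⟨0,⟩⁻ m (k * b) z∈
    ...   | α , α≤n , refl | β , β≤m , refl =
      subst (_∈ Anm k a b n m) (point≡ α β) (∈-Anm⁺ α≤n β≤m)

-- Exponent vectors

0s+v≡v : ∀ {n} (v : Vec ℕ n) → zipWith _+_ (replicate n 0) v ≡ v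
0s+v≡v = zipWith-identityˡ ℕ.+-identityˡ

v+0s≡v : ∀ {n} (v : Vec ℕ n) → zipWith _+_ v (replicate n 0) ≡ v
v+0s≡v = zipWith-identityʳ ℕ.+-identityʳ

drop-++ : ∀ {a} {A : Set a} {m n} (xs : Vec A m) (ys : Vec A n) → V.drop m (xs V.++ ys) ≡ ys
drop-++ []       ys = refl
drop-++ (x ∷ xs) ys = drop-++ xs ys

peel-unit : ∀ {n} (y : Vec ℕ n) k → V.sum y ≡ suc k →
            ∃₂ λ i y′ → y ≡ zipWith _+_ y′ (unit i) × V.sum y′ ≡ k
peel-unit (zero ∷ y) k Σy≡1+k with peel-unit y k Σy≡1+k
... | i , y′ , y≡ , Σy′≡k = Fin.suc i , 0 ∷ y′ , cong (0 ∷_) y≡ , Σy′≡k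
peel-unit (suc h ∷ y) k Σy≡1+k =
  Fin.zero , h ∷ y , cong₂ _∷_ (ℕ.+-comm 1 h) (≡.sym (v+0s≡v y)) , ℕ.suc-injective Σy≡1+k

sum≡0⇒zeros : ∀ {n} (y : Vec ℕ n) → V.sum y ≡ 0 → y ≡ replicate n 0
sum≡0⇒zeros []      _     = refl
sum≡0⇒zeros (h ∷ y) Σy≡0 =
  cong₂ _∷_ (ℕ.m+n≡0⇒m≡0 h Σy≡0) (sum≡0⇒zeros y (ℕ.m+n≡0⇒n≡0 h Σy≡0))

-- Coefficient sums and binomial ideals

module Polynomials {c ℓ} (F : Field c ℓ) where

  open Field F renaming (refl to ≈-refl; sym to ≈-sym; trans to ≈-trans)
  open Poly F
  open import Algebra.Properties.Ring ring using (-‿distribʳ-*)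
  open import Algebra.Properties.AbelianGroup +-abelianGroup
    using (ε⁻¹≈ε; ⁻¹-∙-comm; ⁻¹-involutive; \\-leftDividesˡ; \\-leftDividesʳ)
  open import Algebra.Properties.CommutativeSemigroup +-commutativeSemigroup
    using (interchange; x∙yz≈y∙xz)
  open import Relation.Binary.Reasoning.Setoid setoid

  select : Bool → Carrier → Carrier
  select b x = if b then x else 0#

  select-cong : ∀ b {x y} → x ≈ y → select b x ≈ select b y
  select-cong true  x≈y = x≈y
  select-cong false _   = ≈-refl

  select-0 : ∀ b → select b 0# ≈ 0#
  select-0 true  = ≈-refl
  select-0 false = ≈-refl

  select-+ : ∀ b x y → select b (x +F y) ≈ select b x +F select b y
  select-+ true  x y = ≈-refl
  select-+ false x y = ≈-sym (+-identityˡ 0#)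

  select-neg : ∀ b x → select b (-F x) ≈ -F select b x
  select-neg true  x = ≈-refl
  select-neg false x = ≈-sym ε⁻¹≈ε

  select-comm : ∀ b b′ x → select b (select b′ x) ≡ select b′ (select b x)
  select-comm true  true  x = refl
  select-comm true  false x = refl
  select-comm false true  x = refl
  select-comm false false x = refl

  select-cancel : ∀ b x y → select b x +F (select b (-F x) +F y) ≈ y
  select-cancel true  x y = \\-leftDividesˡ x y
  select-cancel false x y = ≈-trans (+-identityˡ _) (+-identityˡ y)

  select-cancelʳ : ∀ b x y → select b (-F x) +F (select b x +F y) ≈ y
  select-cancelʳ true  x y = \\-leftDividesʳ x y
  select-cancelʳ false x y = ≈-trans (+-identityˡ _) (+-identityˡ y)

  x*-1≈-x : ∀ x → x *F (-F 1#) ≈ -F x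
  x*-1≈-x x = ≈-trans (≈-sym (-‿distribʳ-* x 1#)) (-‿cong (*-identityʳ x))

  sumWhere : ∀ {N} → (Mon N → Bool) → Pol N → Carrier
  sumWhere P []            = 0#
  sumWhere P ((a , e) ∷ f) = select (P e) a +F sumWhere P f

  _≡ᵇ_ : ∀ {N} → Mon N → Mon N → Bool
  e ≡ᵇ e′ = does (≡-dec ℕ._≟_ e e′)

  ≡ᵇ-refl : ∀ {N} (e : Mon N) → (e ≡ᵇ e) ≡ true
  ≡ᵇ-refl e = dec-true (≡-dec ℕ._≟_ e e) refl

  ≢⇒≡ᵇ-false : ∀ {N} {e e′ : Mon N} → ¬ e ≡ e′ → (e ≡ᵇ e′) ≡ false
  ≢⇒≡ᵇ-false {e = e} {e′} = dec-false (≡-dec ℕ._≟_ e e′)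

  coeff≈sumWhere : ∀ {N} (f : Pol N) e → coeff f e ≈ sumWhere (_≡ᵇ e) f
  coeff≈sumWhere []             e = ≈-refl
  coeff≈sumWhere ((a , e′) ∷ f) e with ≡-dec ℕ._≟_ e′ e
  ... | yes _ = +-congˡ (coeff≈sumWhere f e)
  ... | no  _ = ≈-trans (coeff≈sumWhere f e) (≈-sym (+-identityˡ _))

  sumWhere-++ : ∀ {N} P (f g : Pol N) → sumWhere P (f ++ g) ≈ sumWhere P f +F sumWhere P g
  sumWhere-++ P []            g = ≈-sym (+-identityˡ _)
  sumWhere-++ P ((a , e) ∷ f) g = ≈-trans (+-congˡ (sumWhere-++ P f g)) (≈-sym (+-assoc _ _ _))

  sumOver : ∀ {N} → (Mon N → Carrier) → List (Mon N) → Carrier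
  sumOver h []      = 0#
  sumOver h (d ∷ D) = h d +F sumOver h D

  sumOver-cong : ∀ {N} {h h′ : Mon N → Carrier} → (∀ e → h e ≈ h′ e) →
                 ∀ D → sumOver h D ≈ sumOver h′ D
  sumOver-cong h≈h′ []      = ≈-refl
  sumOver-cong h≈h′ (d ∷ D) = +-cong (h≈h′ d) (sumOver-cong h≈h′ D)

  sumOver-+ : ∀ {N} (h h′ : Mon N → Carrier) D →
              sumOver (λ e → h e +F h′ e) D ≈ sumOver h D +F sumOver h′ D
  sumOver-+ h h′ []      = ≈-sym (+-identityˡ 0#)
  sumOver-+ h h′ (d ∷ D) = ≈-trans (+-congˡ (sumOver-+ h h′ D)) (interchange _ _ _ _)

  sumOver-0 : ∀ {N} {h : Mon N → Carrier} {D} → All (λ d → h d ≈ 0#) D → sumOver h D ≈ 0#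
  sumOver-0 []           = ≈-refl
  sumOver-0 (h≈0 ∷ h≈0s) = ≈-trans (+-cong h≈0 (sumOver-0 h≈0s)) (+-identityˡ 0#)

  sumOver-point : ∀ {N} (e₀ : Mon N) (w : Mon N → Carrier) {D} → Unique D → e₀ ∈ D →
                  sumOver (λ e → select (e₀ ≡ᵇ e) (w e)) D ≈ w e₀
  sumOver-point e₀ w {d ∷ D} (d∉D ∷ _) (here refl) rewrite ≡ᵇ-refl e₀ =
    ≈-trans (+-congˡ (sumOver-0 (All.map select-false d∉D))) (+-identityʳ _)
    where
    select-false : ∀ {d} → ¬ e₀ ≡ d → select (e₀ ≡ᵇ d) (w d) ≈ 0#
    select-false e₀≢d = reflexive (cong (λ b → select b _) (≢⇒≡ᵇ-false e₀≢d))
  sumOver-point e₀ w {d ∷ D} (d∉D ∷ uniq) (there e₀∈D)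
    rewrite ≢⇒≡ᵇ-false {e = e₀} {d} (λ { refl → All.lookup d∉D e₀∈D refl }) =
    ≈-trans (+-identityˡ _) (sumOver-point e₀ w uniq e₀∈D)

  sumWhere≈sumOver : ∀ {N} P {D : List (Mon N)} → Unique D →
                     ∀ f → All (λ t → proj₂ t ∈ D) f →
                     sumWhere P f ≈ sumOver (λ e → select (P e) (sumWhere (_≡ᵇ e) f)) D
  sumWhere≈sumOver P {D} uniq [] [] =
    ≈-sym (sumOver-0 (All.tabulate {xs = D} (λ {e} _ → select-0 (P e))))
  sumWhere≈sumOver P {D} uniq ((a , e₀) ∷ f) (e₀∈D ∷ f⊆D) = begin
    select (P e₀) a +F sumWhere P f
      ≈⟨ +-cong (≈-sym (sumOver-point e₀ (λ e → select (P e) a) uniq e₀∈D))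
                (sumWhere≈sumOver P uniq f f⊆D) ⟩
    sumOver (λ e → select (e₀ ≡ᵇ e) (select (P e) a)) D
      +F sumOver (λ e → select (P e) (sumWhere (_≡ᵇ e) f)) D
      ≈⟨ sumOver-+ _ _ D ⟨
    sumOver (λ e → select (e₀ ≡ᵇ e) (select (P e) a) +F select (P e) (sumWhere (_≡ᵇ e) f)) D
      ≈⟨ sumOver-cong split D ⟨
    sumOver (λ e → select (P e) (select (e₀ ≡ᵇ e) a +F sumWhere (_≡ᵇ e) f)) D ∎
    where
    split : ∀ e → select (P e) (select (e₀ ≡ᵇ e) a +F sumWhere (_≡ᵇ e) f)
                ≈ select (e₀ ≡ᵇ e) (select (P e) a) +F select (P e) (sumWhere (_≡ᵇ e) f)
    split e = ≈-trans (select-+ (P e) _ _) (+-congʳ (reflexive (select-comm (P e) (e₀ ≡ᵇ e) a)))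

  sumWhere-cong : ∀ {N} P (f g : Pol N) → f ≈P g → sumWhere P f ≈ sumWhere P g
  sumWhere-cong P f g f≈g = begin
    sumWhere P f                                          ≈⟨ sumWhere≈sumOver P uniq f (⊆D ∈-++⁺ˡ) ⟩
    sumOver (λ e → select (P e) (sumWhere (_≡ᵇ e) f)) D   ≈⟨ sumOver-cong coeffs≈ D ⟩
    sumOver (λ e → select (P e) (sumWhere (_≡ᵇ e) g)) D   ≈⟨ sumWhere≈sumOver P uniq g (⊆D (∈-++⁺ʳ f)) ⟨
    sumWhere P g                                          ∎
    where
    D = L.deduplicate (≡-dec ℕ._≟_) (L.map proj₂ (f ++ g))
    uniq : Unique D
    uniq = deduplicate-! (≡-dec ℕ._≟_) (L.map proj₂ (f ++ g))
    ⊆D : ∀ {h} → (∀ {t} → t ∈ h → t ∈ f ++ g) → All (λ t → proj₂ t ∈ D) h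
    ⊆D h⊆ = All.tabulate (λ t∈h → ∈-deduplicate⁺ (≡-dec ℕ._≟_) (∈-map⁺ proj₂ (h⊆ t∈h)))
    coeffs≈ : ∀ e → select (P e) (sumWhere (_≡ᵇ e) f) ≈ select (P e) (sumWhere (_≡ᵇ e) g)
    coeffs≈ e = select-cong (P e)
      (≈-trans (≈-sym (coeff≈sumWhere f e)) (≈-trans (f≈g e) (coeff≈sumWhere g e)))

  sumWhere-false : ∀ {N} P {f : Pol N} → All (λ t → P (proj₂ t) ≡ false) f → sumWhere P f ≈ 0#
  sumWhere-false P []                = ≈-refl
  sumWhere-false P (P≡false ∷ Ps≡false) rewrite P≡false =
    ≈-trans (+-identityˡ _) (sumWhere-false P Ps≡false)

  sumWhere-agree : ∀ {N} P Q {f : Pol N} → All (λ t → P (proj₂ t) ≡ Q (proj₂ t)) f →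
                   sumWhere P f ≡ sumWhere Q f
  sumWhere-agree P Q {[]}          []          = refl
  sumWhere-agree P Q {(a , _) ∷ f} (P≡Q ∷ Ps≡Qs) =
    cong₂ (λ b s → select b a +F s) P≡Q (sumWhere-agree P Q Ps≡Qs)

  sumWhere-mapMon : ∀ {N M} P (φ : Mon N → Mon M) f →
                    sumWhere P (mapMon φ f) ≡ sumWhere (λ e → P (φ e)) f
  sumWhere-mapMon P φ []            = refl
  sumWhere-mapMon P φ ((a , e) ∷ f) = cong (select (P (φ e)) a +F_) (sumWhere-mapMon P φ f)

  ≈P-byCoeffSums : ∀ {N} (f g : Pol N) → (∀ e → sumWhere (_≡ᵇ e) f ≈ sumWhere (_≡ᵇ e) g) → f ≈P g
  ≈P-byCoeffSums f g sums≈ e =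
    ≈-trans (coeff≈sumWhere f e) (≈-trans (sums≈ e) (≈-sym (coeff≈sumWhere g e)))

  ≈P-++ : ∀ {N} (f f′ g g′ : Pol N) → f ≈P f′ → g ≈P g′ → (f ++ g) ≈P (f′ ++ g′)
  ≈P-++ f f′ g g′ f≈f′ g≈g′ = ≈P-byCoeffSums (f ++ g) (f′ ++ g′) λ e → begin
    sumWhere (_≡ᵇ e) (f ++ g)
      ≈⟨ sumWhere-++ (_≡ᵇ e) f g ⟩
    sumWhere (_≡ᵇ e) f +F sumWhere (_≡ᵇ e) g
      ≈⟨ +-cong (sumWhere-cong (_≡ᵇ e) f f′ f≈f′) (sumWhere-cong (_≡ᵇ e) g g′ g≈g′) ⟩
    sumWhere (_≡ᵇ e) f′ +F sumWhere (_≡ᵇ e) g′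
      ≈⟨ sumWhere-++ (_≡ᵇ e) f′ g′ ⟨
    sumWhere (_≡ᵇ e) (f′ ++ g′) ∎

  module Ideal {N} {I : Set} (gen : I → Pol N) where

    combination : List (Pol N × I) → Pol N
    combination = L.foldr (λ hi acc → (proj₁ hi *P gen (proj₂ hi)) +P acc) 0P

    combination-++ : ∀ hs hs′ → combination (hs ++ hs′) ≡ combination hs ++ combination hs′
    combination-++ []             hs′ = refl
    combination-++ ((h , i) ∷ hs) hs′ = ≡.trans
      (cong ((h *P gen i) ++_) (combination-++ hs hs′))
      (≡.sym (LP.++-assoc (h *P gen i) (combination hs) (combination hs′)))

    InIdeal-[] : InIdeal gen []
    InIdeal-[] = [] , λ _ → ≈-refl

    InIdeal-resp : ∀ f g → f ≈P g → InIdeal gen g → InIdeal gen f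
    InIdeal-resp f g f≈g (hs , g≈) = hs , λ e → ≈-trans (f≈g e) (g≈ e)

    InIdeal-++ : ∀ f g → InIdeal gen f → InIdeal gen g → InIdeal gen (f ++ g)
    InIdeal-++ f g (hs , f≈) (hs′ , g≈) = hs ++ hs′ , λ e → ≈-trans
      (≈P-++ f (combination hs) g (combination hs′) f≈ g≈ e)
      (reflexive (cong (λ h → coeff h e) (≡.sym (combination-++ hs hs′))))

    -- Quantifying over the coefficient x spares us closure of ideals under scalar multiples.
    record Linked (e e′ : Mon N) : Set (c ⊔ ℓ) where
      constructor mkLinked
      field binomial∈ : ∀ x → InIdeal gen ((x , e) ∷ (-F x , e′) ∷ [])

    open Linked public

    Linked-refl : ∀ {e} → Linked e e
    Linked-refl {e} = mkLinked λ x →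
      InIdeal-resp (f x) [] (≈P-byCoeffSums (f x) [] λ d → select-cancel (e ≡ᵇ d) x 0#) InIdeal-[]
      where
      f : Carrier → Pol N
      f x = (x , e) ∷ (-F x , e) ∷ []

    Linked-sym : ∀ {e e′} → Linked e e′ → Linked e′ e
    Linked-sym {e} {e′} (mkLinked e~e′) = mkLinked λ x → InIdeal-resp (f x) (g x) (f≈g x) (e~e′ (-F x))
      where
      f g : Carrier → Pol N
      f x = (x , e′) ∷ (-F x , e) ∷ []
      g x = (-F x , e) ∷ (-F (-F x) , e′) ∷ []
      f≈g : ∀ x → f x ≈P g x
      f≈g x = ≈P-byCoeffSums (f x) (g x) λ d →
        ≈-trans (x∙yz≈y∙xz _ _ _)
                (+-congˡ (+-congʳ (select-cong (e′ ≡ᵇ d) (≈-sym (⁻¹-involutive x)))))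

    Linked-trans : ∀ {e e′ e″} → Linked e e′ → Linked e′ e″ → Linked e e″
    Linked-trans {e} {e′} {e″} (mkLinked e~e′) (mkLinked e′~e″) =
      mkLinked λ x → InIdeal-resp (f x) (g x ++ h x) (f≈gh x) (InIdeal-++ (g x) (h x) (e~e′ x) (e′~e″ x))
      where
      f g h : Carrier → Pol N
      f x = (x , e) ∷ (-F x , e″) ∷ []
      g x = (x , e) ∷ (-F x , e′) ∷ []
      h x = (x , e′) ∷ (-F x , e″) ∷ []
      f≈gh : ∀ x → f x ≈P (g x ++ h x)
      f≈gh x = ≈P-byCoeffSums (f x) (g x ++ h x) λ d → +-congˡ (≈-sym (select-cancelʳ (e′ ≡ᵇ d) x _))

    Linked-move : ∀ i {g g′} → gen i ≡ binom g g′ → ∀ m →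
                  Linked (zipWith _+_ m g) (zipWith _+_ m g′)
    Linked-move i {g} {g′} gen-i≡ m = mkLinked λ x → (((x , m) ∷ [] , i) ∷ []) ,
      subst (λ h → lhs x ≈P (((x , m) ∷ []) *P h ++ [])) (≡.sym gen-i≡) (lhs≈ x)
      where
      lhs : Carrier → Pol N
      lhs x = (x , zipWith _+_ m g) ∷ (-F x , zipWith _+_ m g′) ∷ []
      rhs : Carrier → Pol N
      rhs x = (x *F 1# , zipWith _+_ m g) ∷ (x *F (-F 1#) , zipWith _+_ m g′) ∷ []
      lhs≈ : ∀ x → lhs x ≈P rhs x
      lhs≈ x = ≈P-byCoeffSums (lhs x) (rhs x) λ d →
        +-cong (select-cong (zipWith _+_ m g ≡ᵇ d) (≈-sym (*-identityʳ x)))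
               (+-congʳ (select-cong (zipWith _+_ m g′ ≡ᵇ d) (≈-sym (x*-1≈-x x))))

    Linked-generator : ∀ i {g g′} → gen i ≡ binom g g′ → Linked g g′
    Linked-generator i {g} {g′} gen-i≡ =
      ≡.subst₂ Linked (0s+v≡v g) (0s+v≡v g′) (Linked-move i gen-i≡ (replicate N 0))

  support : ∀ {N} → Pol N → List (Mon N)
  support = L.map proj₂

  module Graded {N} (As : Vec (List ℕ) N) where

    record _∼_ (e e′ : Mon N) : Set where
      constructor mk∼
      field degree≋ : lin e As ≋ lin e′ As

    open _∼_ public

    _∼?_ : Decidable _∼_
    e ∼? e′ = map′ mk∼ degree≋ (lin e As ≋? lin e′ As)

    ∼-refl : ∀ {e} → e ∼ e
    ∼-refl = mk∼ ≋-refl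

    ∼-sym : ∀ {e e′} → e ∼ e′ → e′ ∼ e
    ∼-sym (mk∼ e≋e′) = mk∼ (≋-sym e≋e′)

    ∼-trans : ∀ {e e′ e″} → e ∼ e′ → e′ ∼ e″ → e ∼ e″
    ∼-trans (mk∼ e≋e′) (mk∼ e′≋e″) = mk∼ (≋-trans e≋e′ e′≋e″)

    ∼-+ˡ : ∀ m {g g′} → g ∼ g′ → zipWith _+_ m g ∼ zipWith _+_ m g′
    ∼-+ˡ m {g} {g′} (mk∼ g≋g′) =
      mk∼ (≋-trans (lin-+ m g As)
          (≋-trans (⊕-cong (≋-refl {lin m As}) g≋g′) (≋-sym (lin-+ m g′ As))))

    classSum : Mon N → Pol N → Carrier
    classSum e = sumWhere (λ e′ → does (e′ ∼? e))

    ClassSumsVanish : Pol N → Set ℓ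
    ClassSumsVanish f = ∀ e → e ∈ support f → classSum e f ≈ 0#

    HomogeneousBinomial : Pol N → Set c
    HomogeneousBinomial h = ∃₂ λ g g′ → g ∼ g′ × h ≡ binom g g′

    classSum-*binom≈0 : ∀ e {g g′} → g ∼ g′ → ∀ h → classSum e (h *P binom g g′) ≈ 0#
    classSum-*binom≈0 e             g∼g′ []            = ≈-refl
    classSum-*binom≈0 e {g} {g′} g∼g′ ((a , m) ∷ h) = begin
      select (P (zipWith _+_ m g)) (a *F 1#) +F (select (P (zipWith _+_ m g′)) (a *F (-F 1#)) +F rest)
        ≈⟨ +-cong (select-cong (P (zipWith _+_ m g)) (*-identityʳ a))
                  (+-congʳ (select-cong (P (zipWith _+_ m g′)) (x*-1≈-x a))) ⟩
      select (P (zipWith _+_ m g)) a +F (select (P (zipWith _+_ m g′)) (-F a) +F rest)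
        ≡⟨ cong (λ b → select (P (zipWith _+_ m g)) a +F (select b (-F a) +F rest)) P-m+g′≡P-m+g ⟩
      select (P (zipWith _+_ m g)) a +F (select (P (zipWith _+_ m g)) (-F a) +F rest)
        ≈⟨ select-cancel (P (zipWith _+_ m g)) a rest ⟩
      rest
        ≈⟨ classSum-*binom≈0 e g∼g′ h ⟩
      0# ∎
      where
      P : Mon N → Bool
      P e′ = does (e′ ∼? e)
      rest = classSum e (h *P binom g g′)
      P-m+g′≡P-m+g : P (zipWith _+_ m g′) ≡ P (zipWith _+_ m g)
      P-m+g′≡P-m+g = does-⇔ (mk⇔ (∼-trans (∼-+ˡ m g∼g′)) (∼-trans (∼-+ˡ m (∼-sym g∼g′))))
                            (zipWith _+_ m g′ ∼? e) (zipWith _+_ m g ∼? e)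

    firstEquivalent : List (Mon N) → Mon N → Mon N
    firstEquivalent []       e = e
    firstEquivalent (d ∷ ds) e with d ∼? e
    ... | yes _ = d
    ... | no  _ = firstEquivalent ds e

    firstEquivalent-∼ : ∀ ds e → firstEquivalent ds e ∼ e
    firstEquivalent-∼ []       e = ∼-refl
    firstEquivalent-∼ (d ∷ ds) e with d ∼? e
    ... | yes d∼e = d∼e
    ... | no  _   = firstEquivalent-∼ ds e

    firstEquivalent-cong : ∀ ds {e e′} → e ∼ e′ → e ∈ ds →
                           firstEquivalent ds e ≡ firstEquivalent ds e′
    firstEquivalent-cong (d ∷ ds) {e} {e′} e∼e′ e∈ with d ∼? e | d ∼? e′
    ... | yes _   | yes _    = refl
    ... | yes d∼e | no  d≁e′ = ⊥-elim (d≁e′ (∼-trans d∼e e∼e′))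
    ... | no  d≁e | yes d∼e′ = ⊥-elim (d≁e (∼-trans d∼e′ (∼-sym e∼e′)))
    ... | no  d≁e | no  _ with e∈
    ...   | here refl = ⊥-elim (d≁e ∼-refl)
    ...   | there e∈ds  = firstEquivalent-cong ds e∼e′ e∈ds

    minusRenamed : (Mon N → Mon N) → Pol N → Pol N
    minusRenamed r []            = []
    minusRenamed r ((a , e) ∷ f) = (a , e) ∷ (-F a , r e) ∷ minusRenamed r f

    sumWhere-minusRenamed : ∀ r P f →
      sumWhere P (minusRenamed r f) ≈ sumWhere P f +F -F sumWhere (λ e → P (r e)) f
    sumWhere-minusRenamed r P []            = ≈-sym (≈-trans (+-congˡ ε⁻¹≈ε) (+-identityʳ 0#))
    sumWhere-minusRenamed r P ((a , e) ∷ f) = begin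
      x +F (select (P (r e)) (-F a) +F sumWhere P (minusRenamed r f))
        ≈⟨ +-congˡ (+-cong (select-neg (P (r e)) a) (sumWhere-minusRenamed r P f)) ⟩
      x +F (-F y +F (s +F -F t))   ≈⟨ +-congˡ (x∙yz≈y∙xz _ _ _) ⟩
      x +F (s +F (-F y +F -F t))   ≈⟨ +-assoc x s _ ⟨
      (x +F s) +F (-F y +F -F t)   ≈⟨ +-congˡ (⁻¹-∙-comm y t) ⟩
      (x +F s) +F -F (y +F t)      ∎
      where
      x = select (P e) a
      y = select (P (r e)) a
      s = sumWhere P f
      t = sumWhere (λ e → P (r e)) f

    module _ {I : Set} (gen : I → Pol N) where

      open Ideal gen

      InIdeal⇒classSum≈0 : (∀ i → HomogeneousBinomial (gen i)) →
                           ∀ f → InIdeal gen f → ∀ e → classSum e f ≈ 0#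
      InIdeal⇒classSum≈0 homogeneous f (hs , f≈) e =
        ≈-trans (sumWhere-cong _ f (combination hs) f≈) (combination≈0 hs)
        where
        combination≈0 : ∀ hs → classSum e (combination hs) ≈ 0#
        combination≈0 []             = ≈-refl
        combination≈0 ((h , i) ∷ hs) with homogeneous i
        ... | g , g′ , g∼g′ , gen-i≡ = begin
          classSum e ((h *P gen i) ++ combination hs)
            ≈⟨ sumWhere-++ _ (h *P gen i) (combination hs) ⟩
          classSum e (h *P gen i) +F classSum e (combination hs)
            ≡⟨ cong (λ p → classSum e (h *P p) +F classSum e (combination hs)) gen-i≡ ⟩
          classSum e (h *P binom g g′) +F classSum e (combination hs)
            ≈⟨ +-cong (classSum-*binom≈0 e g∼g′ h) (combination≈0 hs) ⟩
          0# +F 0#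
            ≈⟨ +-identityˡ 0# ⟩
          0# ∎

      -- Renaming each monomial of f to the first monomial of f in its class changes f by a sum of
      -- linked binomials, and the renamed polynomial is zero: its coefficient at a class
      -- representative is a class sum of f.
      ClassSumsVanish⇒InIdeal : (∀ {e e′} → e ∼ e′ → Linked e e′) →
                           ∀ f → ClassSumsVanish f → InIdeal gen f
      ClassSumsVanish⇒InIdeal linked f classSums≈0 =
        InIdeal-resp f (minusRenamed r f) f≈ (minusRenamed-InIdeal f)
        where
        r : Mon N → Mon N
        r = firstEquivalent (support f)

        minusRenamed-InIdeal : ∀ g → InIdeal gen (minusRenamed r g)
        minusRenamed-InIdeal []            = InIdeal-[]
        minusRenamed-InIdeal ((a , e) ∷ g) = InIdeal-++ ((a , e) ∷ (-F a , r e) ∷ []) (minusRenamed r g)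
          (binomial∈ (linked (∼-sym (firstEquivalent-∼ (support f) e))) a) (minusRenamed-InIdeal g)

        fibre≈0 : ∀ e₀ → sumWhere (λ e → r e ≡ᵇ e₀) f ≈ 0#
        fibre≈0 e₀ with any? (λ t → ≡-dec ℕ._≟_ (r (proj₂ t)) e₀) f
        ... | no ¬hit = sumWhere-false _ (All.map ≢⇒≡ᵇ-false (¬Any⇒All¬ f ¬hit))
        ... | yes hit with find hit
        ...   | (_ , e₁) , t₁∈f , re₁≡e₀ =
          ≈-trans (reflexive (sumWhere-agree _ _ (All.tabulate fibre≡class)))
                  (classSums≈0 e₁ (∈-map⁺ proj₂ t₁∈f))
          where
          fibre≡class : ∀ {t} → t ∈ f → (r (proj₂ t) ≡ᵇ e₀) ≡ does (proj₂ t ∼? e₁)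
          fibre≡class {_ , e} t∈f = does-⇔ (mk⇔ into onto) (≡-dec ℕ._≟_ (r e) e₀) (e ∼? e₁)
            where
            into : r e ≡ e₀ → e ∼ e₁
            into re≡e₀ = ∼-trans (∼-sym (firstEquivalent-∼ (support f) e))
              (subst (_∼ e₁) (≡.trans re₁≡e₀ (≡.sym re≡e₀)) (firstEquivalent-∼ (support f) e₁))
            onto : e ∼ e₁ → r e ≡ e₀
            onto e∼e₁ = ≡.trans (firstEquivalent-cong (support f) e∼e₁ (∈-map⁺ proj₂ t∈f)) re₁≡e₀

        f≈ : f ≈P minusRenamed r f
        f≈ = ≈P-byCoeffSums f (minusRenamed r f) λ e₀ → ≈-sym (begin
          sumWhere (_≡ᵇ e₀) (minusRenamed r f)                    ≈⟨ sumWhere-minusRenamed r (_≡ᵇ e₀) f ⟩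
          sumWhere (_≡ᵇ e₀) f +F -F sumWhere (λ e → r e ≡ᵇ e₀) f  ≈⟨ +-congˡ (-‿cong (fibre≈0 e₀)) ⟩
          sumWhere (_≡ᵇ e₀) f +F -F 0#                            ≈⟨ +-congˡ ε⁻¹≈ε ⟩
          sumWhere (_≡ᵇ e₀) f +F 0#                               ≈⟨ +-identityʳ _ ⟩
          sumWhere (_≡ᵇ e₀) f                                     ∎)

      InIdeal⇔ClassSumsVanish : (∀ i → HomogeneousBinomial (gen i)) →
                                (∀ {e e′} → e ∼ e′ → Linked e e′) →
                                ∀ f → InIdeal gen f ⇔ ClassSumsVanish f
      InIdeal⇔ClassSumsVanish homogeneous linked f =
        mk⇔ (λ f∈ e _ → InIdeal⇒classSum≈0 homogeneous f f∈ e) (ClassSumsVanish⇒InIdeal linked f)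

  support-mapMon : ∀ {N M} (φ : Mon N → Mon M) f → support (mapMon φ f) ≡ L.map φ (support f)
  support-mapMon φ []            = refl
  support-mapMon φ ((_ , e) ∷ f) = cong (φ e ∷_) (support-mapMon φ f)

  module _ {N M} (As : Vec (List ℕ) N) (Bs : Vec (List ℕ) M) (φ : Mon N → Mon M)
           (degree-φ : ∀ e → lin (φ e) Bs ≋ lin e As) where

    private
      module A = Graded As
      module B = Graded Bs

    classSum-mapMon : ∀ e f → B.classSum (φ e) (mapMon φ f) ≡ A.classSum e f
    classSum-mapMon e f =
      ≡.trans (sumWhere-mapMon _ φ f) (sumWhere-agree _ _ {f} (All.tabulate λ {(_ , e′)} _ →
        does-⇔ (mk⇔ (reflect e′) (preserve e′)) (φ e′ B.∼? φ e) (e′ A.∼? e)))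
      where
      reflect : ∀ e′ → φ e′ B.∼ φ e → e′ A.∼ e
      reflect e′ (B.mk∼ φe′≋φe) = A.mk∼ (≋-trans (≋-sym (degree-φ e′)) (≋-trans φe′≋φe (degree-φ e)))
      preserve : ∀ e′ → e′ A.∼ e → φ e′ B.∼ φ e
      preserve e′ (A.mk∼ e′≋e) = B.mk∼ (≋-trans (degree-φ e′) (≋-trans e′≋e (≋-sym (degree-φ e))))

    ClassSumsVanish-mapMon : ∀ f → A.ClassSumsVanish f ⇔ B.ClassSumsVanish (mapMon φ f)
    ClassSumsVanish-mapMon f = mk⇔ forth back
      where
      forth : A.ClassSumsVanish f → B.ClassSumsVanish (mapMon φ f)
      forth sums≈0 e e∈ with ∈-map⁻ φ (subst (e ∈_) (support-mapMon φ f) e∈)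
      ... | e′ , e′∈ , refl = ≈-trans (reflexive (classSum-mapMon e′ f)) (sums≈0 e′ e′∈)
      back : B.ClassSumsVanish (mapMon φ f) → A.ClassSumsVanish f
      back sums≈0 e e∈ = ≈-trans (reflexive (≡.sym (classSum-mapMon e f)))
        (sums≈0 (φ e) (subst (φ e ∈_) (≡.sym (support-mapMon φ f)) (∈-map⁺ φ e∈)))

-- The gradings of S, S′ and the big ring

module Degrees (k a b p s u : ℕ) (bs : Fin p → ℕ) (as : Fin s → ℕ) (nm : Fin (s + u) → ℕ × ℕ) where

  open ≋-Reasoning

  GS : Vec (List ℕ) (p + (s + u))
  GS = gensS k a b p s u bs as nm

  GS′ : Vec (List ℕ) (p + (s + 2))
  GS′ = gensS' k a b p s bs as

  singletonsB : Vec (List ℕ) p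
  singletonsB = V.tabulate (λ j → bs j ∷ [])

  singletonsA : Vec (List ℕ) s
  singletonsA = V.tabulate (λ i → as i ∷ [])

  XY : Vec (List ℕ) 2
  XY = ⟨0, k * a ⟩ ∷ ⟨0, k * b ⟩ ∷ []

  GZ : Vec (List ℕ) (s + u)
  GZ = V.drop p GS

  -- xⱼ, wᵢ, x, y get their degrees in S′ and zᵢ the degree of the i-th generator of S.
  GB : Vec (List ℕ) (Big p s u)
  GB = GS′ V.++ GZ

  GS≡ : GS ≡ singletonsB V.++ GZ
  GS≡ = cong (singletonsB V.++_) (≡.sym (drop-++ singletonsB _))

  degree-inclXZ : ∀ e → lin (inclXZ p s u e) GB ≋ lin e GS
  degree-inclXZ e with V.splitAt p e
  ... | ex , ez , refl = begin
    lin ((ex V.++ replicate (s + 2) 0) V.++ ez) GB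
      ≈⟨ lin-++ (ex V.++ replicate (s + 2) 0) ez GS′ GZ ⟩
    lin (ex V.++ replicate (s + 2) 0) GS′ ⊕ lin ez GZ
      ≈⟨ ⊕-cong (lin-++ ex (replicate (s + 2) 0) singletonsB (singletonsA V.++ XY)) ≋-refl ⟩
    (lin ex singletonsB ⊕ lin (replicate (s + 2) 0) (singletonsA V.++ XY)) ⊕ lin ez GZ
      ≈⟨ ⊕-cong (⊕-cong (≋-refl {lin ex singletonsB}) (lin-zeros (singletonsA V.++ XY))) ≋-refl ⟩
    (lin ex singletonsB ⊕ [0]) ⊕ lin ez GZ
      ≈⟨ ⊕-cong (⊕-identityʳ (lin ex singletonsB)) ≋-refl ⟩
    lin ex singletonsB ⊕ lin ez GZ
      ≈⟨ lin-++ ex ez singletonsB GZ ⟨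
    lin (ex V.++ ez) (singletonsB V.++ GZ)
      ≡⟨ cong (lin (ex V.++ ez)) GS≡ ⟨
    lin (ex V.++ ez) GS ∎

  degree-inclS′ : ∀ α → lin (inclS' p s u α) GB ≋ lin α GS′
  degree-inclS′ α = begin
    lin (α V.++ replicate (s + u) 0) GB        ≈⟨ lin-++ α (replicate (s + u) 0) GS′ GZ ⟩
    lin α GS′ ⊕ lin (replicate (s + u) 0) GZ   ≈⟨ ⊕-cong (≋-refl {lin α GS′}) (lin-zeros GZ) ⟩
    lin α GS′ ⊕ [0]                            ≈⟨ ⊕-identityʳ (lin α GS′) ⟩
    lin α GS′                                  ∎

  zGenerator : Fin s ⊎ Fin u → ℕ × ℕ → List ℕ
  zGenerator (inj₁ i) (n , m) = (as i ∷ []) ⊕ Anm k a b n m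
  zGenerator (inj₂ _) (n , m) = Anm k a b n m

  lookup-GZ : ∀ i → V.lookup GZ i ≡ zGenerator (splitAt s i) (nm i)
  lookup-GZ i
    rewrite (V.lookup GZ i ≡ _) ∋
              ≡.trans (cong (λ v → V.lookup v i) (drop-++ singletonsB _)) (lookup∘tabulate _ i)
    with splitAt s i
  ... | inj₁ _ = refl
  ... | inj₂ _ = refl

  wxyExponent : Fin s ⊎ Fin u → ℕ × ℕ → Vec ℕ (p + (s + 2))
  wxyExponent x (n , m) = replicate p 0 V.++ (wPart x V.++ (n ∷ m ∷ []))
    where
    wPart : Fin s ⊎ Fin u → Vec ℕ s
    wPart (inj₁ i) = unit i
    wPart (inj₂ _) = replicate s 0

  wxyOf : Fin (s + u) → Vec ℕ (p + (s + 2))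
  wxyOf i = wxyExponent (splitAt s i) (nm i)

  wxyMon≡inclS′ : ∀ i → wxyMon p s u nm i ≡ inclS' p s u (wxyOf i)
  wxyMon≡inclS′ i with splitAt s i
  ... | inj₁ _ = refl
  ... | inj₂ _ = refl

  degree-xy : ∀ n m → lin (n ∷ m ∷ []) XY ≋ Anm k a b n m
  degree-xy n m = begin
    (n ⊗ ⟨0, k * a ⟩) ⊕ ((m ⊗ ⟨0, k * b ⟩) ⊕ [0])  ≈⟨ ⊕-cong (≋-refl {n ⊗ ⟨0, k * a ⟩}) (⊕-identityʳ _) ⟩
    (n ⊗ ⟨0, k * a ⟩) ⊕ (m ⊗ ⟨0, k * b ⟩)          ≈⟨ Anm≋⊗⊕⊗ k a b n m ⟨
    Anm k a b n m                                 ∎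

  degree-wxy : ∀ w n m →
               lin (replicate p 0 V.++ (w V.++ (n ∷ m ∷ []))) GS′ ≋ (lin w singletonsA ⊕ Anm k a b n m)
  degree-wxy w n m = begin
    lin (replicate p 0 V.++ (w V.++ (n ∷ m ∷ []))) GS′
      ≈⟨ lin-++ (replicate p 0) (w V.++ (n ∷ m ∷ [])) singletonsB (singletonsA V.++ XY) ⟩
    lin (replicate p 0) singletonsB ⊕ lin (w V.++ (n ∷ m ∷ [])) (singletonsA V.++ XY)
      ≈⟨ ⊕-cong (lin-zeros singletonsB) (lin-++ w (n ∷ m ∷ []) singletonsA XY) ⟩
    [0] ⊕ (lin w singletonsA ⊕ lin (n ∷ m ∷ []) XY)
      ≈⟨ ⊕-identityˡ _ ⟩
    lin w singletonsA ⊕ lin (n ∷ m ∷ []) XY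
      ≈⟨ ⊕-cong (≋-refl {lin w singletonsA}) (degree-xy n m) ⟩
    lin w singletonsA ⊕ Anm k a b n m
      ∎

  degree-wxyExponent : ∀ x q → lin (wxyExponent x q) GS′ ≋ zGenerator x q
  degree-wxyExponent (inj₁ i) (n , m) = ≋-trans (degree-wxy (unit i) n m)
    (⊕-cong (≋-trans (lin-unit i singletonsA) (≡⇒≋ (lookup∘tabulate (λ i → as i ∷ []) i)))
            (≋-refl {Anm k a b n m}))
  degree-wxyExponent (inj₂ _) (n , m) = ≋-trans (degree-wxy (replicate s 0) n m)
    (≋-trans (⊕-cong (lin-zeros singletonsA) (≋-refl {Anm k a b n m})) (⊕-identityˡ _))

  degree-zMon≋degree-wxyMon : ∀ i → lin (zMon p s u i) GB ≋ lin (wxyMon p s u nm i) GB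
  degree-zMon≋degree-wxyMon i = begin
    lin (replicate (p + (s + 2)) 0 V.++ unit i) GB         ≈⟨ lin-++ (replicate _ 0) (unit i) GS′ GZ ⟩
    lin (replicate (p + (s + 2)) 0) GS′ ⊕ lin (unit i) GZ  ≈⟨ ⊕-cong (lin-zeros GS′) (lin-unit i GZ) ⟩
    [0] ⊕ V.lookup GZ i                                    ≈⟨ ⊕-identityˡ _ ⟩
    V.lookup GZ i                                          ≡⟨ lookup-GZ i ⟩
    zGenerator (splitAt s i) (nm i)                        ≈⟨ degree-wxyExponent (splitAt s i) (nm i) ⟨
    lin (wxyOf i) GS′                                      ≈⟨ degree-inclS′ (wxyOf i) ⟨
    lin (inclS' p s u (wxyOf i)) GB                        ≡⟨ cong (λ e → lin e GB) (wxyMon≡inclS′ i) ⟨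
    lin (wxyMon p s u nm i) GB                             ∎

module Elimination {c ℓ} (F : Field c ℓ) (k a b p s u : ℕ) (bs : Fin p → ℕ) (as : Fin s → ℕ)
                   (nm : Fin (s + u) → ℕ × ℕ) where

  open Poly F
  open Polynomials F
  open Degrees k a b p s u bs as nm

  module B = Graded GB
  module S = Graded GS

  J : SIdx GS′ ⊎ Fin (s + u) → Pol (Big p s u)
  J = Thm.Jgen F k a b p s u bs as nm

  open Ideal J

  J-homogeneous : ∀ i → B.HomogeneousBinomial (J i)
  J-homogeneous (inj₁ ((α , β) , α≋β)) = inclS' p s u α , inclS' p s u β ,
    B.mk∼ (≋-trans (degree-inclS′ α) (≋-trans α≋β (≋-sym (degree-inclS′ β)))) , refl
  J-homogeneous (inj₂ i) = zMon p s u i , wxyMon p s u nm i , B.mk∼ (degree-zMon≋degree-wxyMon i) , refl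

  Joined : Mon (Big p s u) → Mon (Big p s u) → Set (c ⊔ ℓ)
  Joined e e′ = e B.∼ e′ × Linked e e′

  z⇒wxy : ∀ x y i → Joined (x V.++ zipWith _+_ y (unit i)) (zipWith _+_ x (wxyOf i) V.++ y)
  z⇒wxy x y i = ≡.subst₂ Joined z-side w-side
    (B.∼-+ˡ (x V.++ y) (B.mk∼ (degree-zMon≋degree-wxyMon i)) , Linked-move (inj₂ i) refl (x V.++ y))
    where
    z-side : zipWith _+_ (x V.++ y) (zMon p s u i) ≡ x V.++ zipWith _+_ y (unit i)
    z-side = begin
      zipWith _+_ (x V.++ y) (zMon p s u i)                     ≡⟨ zipWith-++ _+_ x y (replicate _ 0) (unit i) ⟩
      zipWith _+_ x (replicate _ 0) V.++ zipWith _+_ y (unit i) ≡⟨ cong (V._++ zipWith _+_ y (unit i)) (v+0s≡v x) ⟩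
      x V.++ zipWith _+_ y (unit i)                             ∎
      where open ≡.≡-Reasoning
    w-side : zipWith _+_ (x V.++ y) (wxyMon p s u nm i) ≡ zipWith _+_ x (wxyOf i) V.++ y
    w-side = begin
      zipWith _+_ (x V.++ y) (wxyMon p s u nm i)                  ≡⟨ cong (zipWith _+_ (x V.++ y)) (wxyMon≡inclS′ i) ⟩
      zipWith _+_ (x V.++ y) (wxyOf i V.++ replicate _ 0)         ≡⟨ zipWith-++ _+_ x y (wxyOf i) (replicate _ 0) ⟩
      zipWith _+_ x (wxyOf i) V.++ zipWith _+_ y (replicate _ 0)  ≡⟨ cong (zipWith _+_ x (wxyOf i) V.++_) (v+0s≡v y) ⟩
      zipWith _+_ x (wxyOf i) V.++ y                              ∎
      where open ≡.≡-Reasoning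

  eliminate-z : ∀ n x y → V.sum y ≡ n → ∃ λ α → Joined (x V.++ y) (inclS' p s u α)
  eliminate-z zero x y Σy≡0 rewrite sum≡0⇒zeros y Σy≡0 = x , B.∼-refl , Linked-refl
  eliminate-z (suc n) x y Σy≡1+n with peel-unit y n Σy≡1+n
  ... | i , y′ , refl , Σy′≡n with z⇒wxy x y′ i | eliminate-z n (zipWith _+_ x (wxyOf i)) y′ Σy′≡n
  ...   | ∼wxy , ~wxy | α , ∼α , ~α = α , B.∼-trans ∼wxy ∼α , Linked-trans ~wxy ~α

  eliminate : ∀ e → ∃ λ α → Joined e (inclS' p s u α)
  eliminate e with V.splitAt (p + (s + 2)) e
  ... | x , y , refl = eliminate-z (V.sum y) x y refl

  J-linked : ∀ {e e′} → e B.∼ e′ → Linked e e′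
  J-linked {e} {e′} e∼e′ with eliminate e | eliminate e′
  ... | α , e∼α , e~α | β , e′∼β , e′~β =
    Linked-trans e~α (Linked-trans (Linked-generator (inj₁ ((α , β) , α≋β)) refl) (Linked-sym e′~β))
    where
    α≋β : lin α GS′ ≋ lin β GS′
    α≋β = ≋-trans (≋-sym (degree-inclS′ α))
            (≋-trans (B.degree≋ (B.∼-trans (B.∼-sym e∼α) (B.∼-trans e∼e′ e′∼β)))
                     (degree-inclS′ β))

  S-homogeneous : ∀ i → S.HomogeneousBinomial (sgen GS i)
  S-homogeneous ((e , e′) , e≋e′) = e , e′ , S.mk∼ e≋e′ , refl

  S-linked : ∀ {e e′} → e S.∼ e′ → Ideal.Linked (sgen GS) e e′
  S-linked {e} {e′} (S.mk∼ e≋e′) = Ideal.Linked-generator (sgen GS) ((e , e′) , e≋e′) refl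

theorem11 : ∀ {c ℓ} (F : Field c ℓ) (a b k : ℕ) → 0 < a → a < b → gcd a b ≡ 1 → 0 < k →
    (p s u : ℕ) (nm : Fin (s + u) → ℕ × ℕ) → (∀ i → 0 < proj₁ (nm i) + proj₂ (nm i)) →
    (bs : Fin p → ℕ) → (∀ j → 0 < bs j) → (as : Fin s → ℕ) → (∀ i → 0 < as i) →
    (f : Poly.Pol F (p + (s + u))) →
    Poly.InIS F (gensS k a b p s u bs as nm) f
      ⇔ Poly.InIdeal F (Thm.Jgen F k a b p s u bs as nm) (Poly.mapMon F (inclXZ p s u) f)
theorem11 F a b k _ _ _ _ p s u nm _ bs _ as _ f =
  ⇔-sym (B.InIdeal⇔ClassSumsVanish J J-homogeneous J-linked (mapMon (inclXZ p s u) f))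
    ⇔-∘ (ClassSumsVanish-mapMon GS GB (inclXZ p s u) degree-inclXZ f
    ⇔-∘ S.InIdeal⇔ClassSumsVanish (sgen GS) S-homogeneous S-linked f)
  where
  open Poly F
  open Polynomials F
  open Degrees k a b p s u bs as nm
  open Elimination F k a b p s u bs as nm
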